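{- For all reasons $r,s\in R$ and all formulas $\varphi,\psi\in F$: $\mathsf{RBB}_\sigma\vdash (Bs\land Br\land s:(\varphi\to\psi)\land r:\varphi)\to B\psi$.
   Context: $P$ (propositional letters) and $R$ (reason symbols) are nonempty sets, with $R$ containing a distinguished symbol $\sigma$ (the "master reason"). $F$: $\varphi ::= p \mid \neg\varphi \mid (\varphi\lor\varphi) \mid (r:\varphi) \mid r \mid B\varphi$, $p\in P$, $r\in R$; the colon binds more strongly than Boolean connectives. $\mathsf{RBB}$ has axiom schemes (CL) classical propositional tautologies; (RK) $r:(\varphi\to\psi)\to(r:\varphi\to r:\psi)$; (A) $r:\varphi\to(r\to\varphi)$; (RB) $r:\varphi\to(Br\to B\varphi)$; (D) $B\varphi\to\neg B\neg\varphi$; rules (MP) modus ponens, (RN) from $\varphi$ infer $r:\varphi$, (E) from $\varphi\leftrightarrow\psi$ infer $B\varphi\leftrightarrow B\psi$. $\mathsf{RBB}_\sigma$ is $\mathsf{RBB}$ plus the schemes (MA) $\sigma\to(Br\to r)$, (MB) $B\sigma$, (MR) $r:\varphi\to(Br\to\sigma:\varphi)$, for all $r\in R$, $\varphi\in F$. -}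

module Defs where

open import Data.Bool using (Bool; true; false; not; _∨_)
open import Relation.Binary.PropositionalEquality using (_≡_)

data Fm (P R : Set) : Set where
  var  : P → Fm P R
  ¬'_  : Fm P R → Fm P R
  _∨'_ : Fm P R → Fm P R → Fm P R
  _∶_  : R → Fm P R → Fm P R
  rsn  : R → Fm P R
  B    : Fm P R → Fm P R

infixr 20 ¬'_
infixl 17 _∨'_
infix 21 _∶_

module _ {P R : Set} where
  infixl 18 _∧'_
  infixr 16 _⇒_
  infixr 15 _⇔_

  _⇒_ : Fm P R → Fm P R → Fm P R
  φ ⇒ ψ = (¬' φ) ∨' ψ

  _∧'_ : Fm P R → Fm P R → Fm P R
  φ ∧' ψ = ¬' ((¬' φ) ∨' (¬' ψ))

  _⇔_ : Fm P R → Fm P R → Fm P R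
  φ ⇔ ψ = (φ ⇒ ψ) ∧' (ψ ⇒ φ)

  -- A Boolean valuation: assigns truth values to all formulas, respecting ¬ and ∨
  -- (formulas r:φ, r, Bφ and letters are treated as propositional atoms).
  record Valuation : Set where
    field
      val   : Fm P R → Bool
      val-¬ : ∀ φ → val (¬' φ) ≡ not (val φ)
      val-∨ : ∀ φ ψ → val (φ ∨' ψ) ≡ (val φ ∨ val ψ)

  Tautology : Fm P R → Set
  Tautology φ = (v : Valuation) → Valuation.val v φ ≡ true

data RBBσ⊢ {P R : Set} (σ : R) : Fm P R → Set where
  CL : ∀ {φ} → Tautology φ → RBBσ⊢ σ φ
  RK : ∀ r φ ψ → RBBσ⊢ σ ((r ∶ (φ ⇒ ψ)) ⇒ ((r ∶ φ) ⇒ (r ∶ ψ)))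
  A  : ∀ r φ → RBBσ⊢ σ ((r ∶ φ) ⇒ (rsn r ⇒ φ))
  RB : ∀ r φ → RBBσ⊢ σ ((r ∶ φ) ⇒ (B (rsn r) ⇒ B φ))
  D  : ∀ φ → RBBσ⊢ σ (B φ ⇒ ¬' (B (¬' φ)))
  MA : ∀ r → RBBσ⊢ σ (rsn σ ⇒ (B (rsn r) ⇒ rsn r))
  MB : RBBσ⊢ σ (B (rsn σ))
  MR : ∀ r φ → RBBσ⊢ σ ((r ∶ φ) ⇒ (B (rsn r) ⇒ (σ ∶ φ)))
  MP : ∀ {φ ψ} → RBBσ⊢ σ (φ ⇒ ψ) → RBBσ⊢ σ φ → RBBσ⊢ σ ψ
  RN : ∀ {φ} r → RBBσ⊢ σ φ → RBBσ⊢ σ (r ∶ φ)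
  E  : ∀ {φ ψ} → RBBσ⊢ σ (φ ⇔ ψ) → RBBσ⊢ σ (B φ ⇔ B ψ)

module Submission where

-- If s and r are believed reasons (Bs, Br), the master-reason axiom (MR)
-- transfers their contents to the master reason σ: from s:(φ → ψ) and r:φ we
-- get σ:(φ → ψ) and σ:φ.  Since σ is a reason like any other, (RK) closes its
-- contents under modus ponens, giving σ:ψ.  Finally σ itself is believed (MB),
-- so (RB) turns σ:ψ into Bψ.

open import Defs
open import Data.Bool using (true; false)
open import Data.Product using (_×_; _,_)
open import Relation.Binary.PropositionalEquality using (_≡_; refl)

module Evaluation {P R : Set} (v : Valuation {P} {R}) where
  open Valuation v

  ⇒-intro : ∀ X Y → (val X ≡ true → val Y ≡ true) → val (X ⇒ Y) ≡ true
  ⇒-intro X Y f with val X | val-¬ X | val-∨ (¬' X) Y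
  ... | false | n | o rewrite n | o = refl
  ... | true  | n | o rewrite n | o = f refl

  ⇒-elim : ∀ X Y → val (X ⇒ Y) ≡ true → val X ≡ true → val Y ≡ true
  ⇒-elim X Y h x rewrite val-∨ (¬' X) Y | val-¬ X | x = h

  ∧-elim : ∀ X Y → val (X ∧' Y) ≡ true → (val X ≡ true) × (val Y ≡ true)
  ∧-elim X Y h
    rewrite val-¬ ((¬' X) ∨' (¬' Y)) | val-∨ (¬' X) (¬' Y) | val-¬ X | val-¬ Y
    with val X | val Y | h
  ... | true  | true  | _  = refl , refl
  ... | true  | false | ()
  ... | false | _     | ()

module _ {P R : Set} {σ : R} where

  discharge : {X Y Z : Fm P R} →
    RBBσ⊢ σ (X ⇒ (Y ⇒ Z)) → RBBσ⊢ σ Y → RBBσ⊢ σ (X ⇒ Z)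
  discharge {X} {Y} {Z} h y = MP (MP (CL swap) h) y
    where
    swap : Tautology ((X ⇒ (Y ⇒ Z)) ⇒ (Y ⇒ (X ⇒ Z)))
    swap v = ⇒-intro _ _ λ hxyz → ⇒-intro _ _ λ hy → ⇒-intro _ _ λ hx →
               ⇒-elim _ _ (⇒-elim _ _ hxyz hx) hy
      where open Evaluation v

  chain : {a b c d e f g k : Fm P R} →
    RBBσ⊢ σ (c ⇒ (a ⇒ e)) → RBBσ⊢ σ (d ⇒ (b ⇒ f)) →
    RBBσ⊢ σ (e ⇒ (f ⇒ g)) → RBBσ⊢ σ (g ⇒ k) →
    RBBσ⊢ σ ((((a ∧' b) ∧' c) ∧' d) ⇒ k)
  chain {a} {b} {c} {d} {e} {f} {g} {k} ce df efg gk =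
    MP (MP (MP (MP (CL glue) ce) df) efg) gk
    where
    glue : Tautology ((c ⇒ (a ⇒ e)) ⇒ (d ⇒ (b ⇒ f)) ⇒ (e ⇒ (f ⇒ g)) ⇒
                      (g ⇒ k) ⇒ ((((a ∧' b) ∧' c) ∧' d) ⇒ k))
    glue v = ⇒-intro _ _ λ h-ce → ⇒-intro _ _ λ h-df → ⇒-intro _ _ λ h-efg →
             ⇒-intro _ _ λ h-gk → ⇒-intro _ _ λ h-abcd →
      let abc , vd = ∧-elim _ _ h-abcd
          ab  , vc = ∧-elim _ _ abc
          va  , vb = ∧-elim _ _ ab
          ve = ⇒-elim _ _ (⇒-elim _ _ h-ce vc) va
          vf = ⇒-elim _ _ (⇒-elim _ _ h-df vd) vb
          vg = ⇒-elim _ _ (⇒-elim _ _ h-efg ve) vf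
      in ⇒-elim _ _ h-gk vg
      where open Evaluation v

  master-belief : (χ : Fm P R) → RBBσ⊢ σ ((σ ∶ χ) ⇒ B χ)
  master-belief χ = discharge (RB σ χ) MB

mainTheorem15 : {P R : Set} → (p₀ : P) → (σ : R) → (r s : R) → (φ ψ : Fm P R) →
    RBBσ⊢ σ ((((B (rsn s) ∧' B (rsn r)) ∧' (s ∶ (φ ⇒ ψ))) ∧' (r ∶ φ)) ⇒ B ψ)
mainTheorem15 p₀ σ r s φ ψ =
  chain (MR s (φ ⇒ ψ))
        (MR r φ)
        (RK σ φ ψ)
        (master-belief ψ)
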